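{- Let $n\ge 1$ and $m\ge 2$ be integers, let $G$ be a finite region-connected $n$-simplex graph with chromatic number $\chi(G)=n+1$, and let $c:V(G)\to\{0,1,\dots,n\}$ be a proper vertex coloring of $G$. Let $L_1,L_2:V(G)\to\mathbb{Z}_m$ be labelings. Then there exists a finite sequence of pushes $f_{S_1},\dots,f_{S_t}$ (with each $S_j$ an $n$-simplex of $G$) such that $f_{S_t}\circ\cdots\circ f_{S_1}(L_1)=L_2$ if and only if $P_c[L_1]=P_c[L_2]$.
   Context: All graphs are finite simple graphs. An $n$-simplex of a graph $G$ is a set of $n+1$ vertices of $G$ that are pairwise adjacent. $G$ is an $n$-simplex graph if $G$ is a union of complete subgraphs on $n+1$ vertices (every vertex and every edge of $G$ lies in some $n$-simplex of $G$). Two $n$-simplexes $S,S'$ are adjacent if $|S\cap S'|=n$; $G$ is region-connected if for any two $n$-simplexes $S,S'$ there is a sequence $S=S_1,S_2,\dots,S_t=S'$ of $n$-simplexes with $S_j$ adjacent to $S_{j+1}$ for all $j$. A labeling is a map $L:V(G)\to\mathbb{Z}_m$. For an $n$-simplex $S$, the push $f_S$ sends a labeling $L$ to the labeling $L'$ with $L'(v)=L(v)+1 \pmod m$ for $v\in S$ and $L'(v)=L(v)$ for $v\notin S$. Let $\zeta=e^{2\pi i/m}$. For $0\le k<n$ let $i_k$ be the $n\times n$ complex diagonal matrix with $\zeta$ in diagonal position $k+1$ and $1$ in all other diagonal positions, and let $i_n=\zeta^{m-1}I_n$. For a proper coloring $c:V(G)\to\{0,\dots,n\}$ and a labeling $L$,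 define $P_c[L]=\prod_{v\in V(G)} i_{c(v)}^{\,L(v)}$ (well defined since these matrices commute and satisfy $i_k^m=I_n$). -}

module Defs where

open import Data.Nat using (ℕ; zero; suc; _+_; _*_; _∸_; _≤_; _<_; NonZero)
open import Data.Nat.DivMod using (_mod_)
open import Data.Fin using (Fin; toℕ)
open import Data.Fin.Subset using (Subset; _∈_; _∩_; ∣_∣)
open import Data.Vec using (lookup)
open import Data.Bool using (Bool; true; false; if_then_else_)
open import Data.List using (List; []; _∷_; foldr; foldl; allFin)
open import Data.Product using (Σ; ∃; _×_; _,_; proj₁)
open import Relation.Nullary using (¬_; does)
open import Relation.Binary.PropositionalEquality using (_≡_; _≢_)
open import Relation.Binary.Construct.Closure.ReflexiveTransitive using (Star)
import Data.Nat as ℕ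

record Graph : Set where
  field
    N     : ℕ
    adj   : Fin N → Fin N → Bool
    sym   : ∀ u v → adj u v ≡ adj v u
    irrefl : ∀ v → adj v v ≡ false

module _ (G : Graph) where
  open Graph G

  IsSimplex : ℕ → Subset N → Set
  IsSimplex n S = ∣ S ∣ ≡ suc n × (∀ u v → u ∈ S → v ∈ S → u ≢ v → adj u v ≡ true)

  Simplex : ℕ → Set
  Simplex n = Σ (Subset N) (IsSimplex n)

  IsSimplexGraph : ℕ → Set
  IsSimplexGraph n =
    (∀ v → Σ (Simplex n) λ S → v ∈ proj₁ S) ×
    (∀ u v → adj u v ≡ true → Σ (Simplex n) λ S → u ∈ proj₁ S × v ∈ proj₁ S)

  AdjSimplex : (n : ℕ) → Simplex n → Simplex n → Set
  AdjSimplex n S S' = ∣ proj₁ S ∩ proj₁ S' ∣ ≡ n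

  RegionConnected : ℕ → Set
  RegionConnected n = ∀ (S S' : Simplex n) → Star (AdjSimplex n) S S'

  Proper : {k : ℕ} → (Fin N → Fin k) → Set
  Proper c = ∀ u v → adj u v ≡ true → c u ≢ c v

  ChromaticNumber : ℕ → Set
  ChromaticNumber k =
    (Σ (Fin N → Fin k) Proper) ×
    (∀ j → j < k → ¬ (Σ (Fin N → Fin j) Proper))

  Labeling : ℕ → Set
  Labeling m = Fin N → Fin m

  module _ (m : ℕ) .{{_ : NonZero m}} where

    push : {n : ℕ} → Simplex n → Labeling m → Labeling m
    push S L v = if lookup (proj₁ S) v then (suc (toℕ (L v)) mod m) else L v

    -- applies f_{S_1} first, then f_{S_2}, ..., finally f_{S_t}
    applyPushes : {n : ℕ} → List (Simplex n) → Labeling m → Labeling m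
    applyPushes ss L = foldl (λ L' S → push S L') L ss

    -- An n×n diagonal matrix whose diagonal entries are m-th roots of unity
    -- is represented by its exponent vector: entry j is ζ^(e j).
    DiagMat : ℕ → Set
    DiagMat n = Fin n → Fin m

    idMat : (n : ℕ) → DiagMat n
    idMat n j = 0 mod m

    _⊗_ : {n : ℕ} → DiagMat n → DiagMat n → DiagMat n
    (A ⊗ B) j = (toℕ (A j) + toℕ (B j)) mod m

    _^^_ : {n : ℕ} → DiagMat n → ℕ → DiagMat n
    (A ^^ e) j = (e * toℕ (A j)) mod m

    -- i_k for k < n: ζ at position k+1 (index k), 1 elsewhere; i_n = ζ^(m-1) I_n
    iMat : (n : ℕ) → Fin (suc n) → DiagMat n
    iMat n k j =
      if does (toℕ k ℕ.≟ n) then ((m ∸ 1) mod m)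
      else (if does (toℕ j ℕ.≟ toℕ k) then (1 mod m) else (0 mod m))

    P : {n : ℕ} → (Fin N → Fin (suc n)) → Labeling m → DiagMat n
    P {n} c L = foldr (λ v A → (iMat n (c v) ^^ toℕ (L v)) ⊗ A) (idMat n) (allFin N)

{-# OPTIONS --safe #-}

-- Pushing an n-simplex S adds its indicator 𝟙 S to the labeling, so L₂ is reachable from L₁ exactly
-- when L₂ − L₁ lies in the span of the simplex indicators in (ℤ/m)^V.  Let X k be the total label of
-- colour class k.  The j-th diagonal entry of P_c[L] is ζ^(X j − X n), and an n-simplex has exactly
-- one vertex of each colour, so pushes preserve P_c.  Conversely, adjacent simplices S, S′ differ by
-- one vertex a ∈ S, b ∈ S′ of the same colour, so 𝟙 S − 𝟙 S′ = e_a − e_b; by region-connectedness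
-- e_u − e_v is in the span whenever u and v have the same colour.  Hence every x is congruent, modulo
-- the span, to the vector carrying X k on the colour-k vertex of a fixed simplex S₀; if P_c[x] = I
-- all X k agree and that vector is X n · 𝟙 S₀.

module Submission where

open import Defs

open import Level using (0ℓ)
open import Algebra.Bundles using (Semiring; CommutativeRing)
import Algebra.Properties.AbelianGroup as AbelianGroupProperties
import Algebra.Properties.Ring as RingProperties
import Algebra.Properties.Semiring.Sum as SemiringSum
open import Data.Bool using (true; false; if_then_else_)
open import Data.Empty using (⊥-elim)
open import Data.Fin using (Fin; zero; suc; toℕ; fromℕ; inject₁)
import Data.Fin.Properties as Fin
open import Data.Fin.Relation.Unary.Top using (view; ‵fromℕ; ‵inject₁)
open import Data.Fin.Subset using (Subset; _∈_; _∉_; _∩_; _-_; _⊆_; ∣_∣; ⊤; inside; outside)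
open import Data.Fin.Subset.Properties
  using (_∈?_; ∈⊤; ∣⊤∣≡n; ∩-comm; x∈p∧x≢y⇒x∈p-y; x∈p⇒∣p-x∣<∣p∣; x∈p∩q⁻; p⊆q⇒∣p∣≤∣q∣)
open import Data.List as List using (List; []; _∷_; _++_)
import Data.List.Properties as List
open import Data.Nat using (ℕ; zero; suc; _∸_; _%_; _≤_; _<_; NonZero; z≤n; s≤s)
import Data.Nat as ℕ
import Data.Nat.ListAction as ℕ
import Data.Nat.ListAction.Properties as ℕ
import Data.Nat.Properties as ℕ
open import Data.Nat.DivMod using (_mod_; %-distribˡ-+; %-distribˡ-*; m*n%n≡0; m%n%n≡m%n; m<n⇒m%n≡m)
open import Data.Product using (∃; _×_; _,_; proj₁; proj₂)
open import Data.Vec using ([]; _∷_; here; there; lookup)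
open import Data.Vec.Functional using (Vector; replicate)
import Data.Vec.Functional.Relation.Binary.Equality.Setoid as VecEquality
open import Data.Vec.Properties using ([]=⇒lookup; lookup⇒[]=)
open import Function.Base using (id; _∘_; _on_; flip)
open import Function.Bundles using (_⇔_; mk⇔)
import Function.Properties.Equivalence as Equivalence
open import Relation.Binary.Construct.Closure.ReflexiveTransitive using (Star; ε; _◅_)
import Relation.Binary.Construct.On as On
open import Relation.Binary.PropositionalEquality
  using (_≡_; _≢_; refl; cong; cong₂; isEquivalence; module ≡-Reasoning)
import Relation.Binary.PropositionalEquality as ≡
import Relation.Binary.Reasoning.Setoid as SetoidReasoning
open import Relation.Nullary using (Dec; yes; no; _×-dec_; contradiction)
open import Relation.Nullary.Decidable using (decidable-stable; dec-true; dec-false)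

module KroneckerDelta {c ℓ} (R : Semiring c ℓ) where
  open Semiring R hiding (refl; zero)
  open SemiringSum R
  open VecEquality setoid using (_≋_)
  open SetoidReasoning setoid

  δ : ∀ {K} → Fin K → Fin K → Carrier
  δ zero    zero    = 1#
  δ zero    (suc _) = 0#
  δ (suc _) zero    = 0#
  δ (suc i) (suc j) = δ i j

  δ-refl : ∀ {K} (i : Fin K) → δ i i ≡ 1#
  δ-refl zero    = refl
  δ-refl (suc i) = δ-refl i

  δ-≢ : ∀ {K} {i j : Fin K} → i ≢ j → δ i j ≡ 0#
  δ-≢ {i = zero}  {zero}  i≢j = ⊥-elim (i≢j refl)
  δ-≢ {i = zero}  {suc j} i≢j = refl
  δ-≢ {i = suc i} {zero}  i≢j = refl
  δ-≢ {i = suc i} {suc j} i≢j = δ-≢ (i≢j ∘ cong suc)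

  ∑-δˡ : ∀ {K} (i : Fin K) (f : Vector Carrier K) → ∑[ j < K ] (δ i j * f j) ≈ f i
  ∑-δˡ {suc K} zero f = begin
    1# * f zero + ∑[ j < K ] (0# * f (suc j)) ≈⟨ +-cong (*-identityˡ _) (sum-cong-≋ (zeroˡ ∘ f ∘ suc)) ⟩
    f zero + ∑[ j < K ] 0#                    ≈⟨ +-congˡ (sum-replicate-zero K) ⟩
    f zero + 0#                               ≈⟨ +-identityʳ _ ⟩
    f zero                                    ∎
  ∑-δˡ {suc K} (suc i) f = begin
    0# * f zero + ∑[ j < K ] (δ i j * f (suc j)) ≈⟨ +-cong (zeroˡ _) (∑-δˡ i (f ∘ suc)) ⟩
    0# + f (suc i)                               ≈⟨ +-identityˡ _ ⟩
    f (suc i)                                    ∎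

  ∑-δʳ : ∀ {K} (f : Vector Carrier K) (j : Fin K) → ∑[ i < K ] (f i * δ i j) ≈ f j
  ∑-δʳ {suc K} f zero = begin
    f zero * 1# + ∑[ i < K ] (f (suc i) * 0#) ≈⟨ +-cong (*-identityʳ _) (sum-cong-≋ (zeroʳ ∘ f ∘ suc)) ⟩
    f zero + ∑[ i < K ] 0#                    ≈⟨ +-congˡ (sum-replicate-zero K) ⟩
    f zero + 0#                               ≈⟨ +-identityʳ _ ⟩
    f zero                                    ∎
  ∑-δʳ {suc K} f (suc j) = begin
    f zero * 0# + ∑[ i < K ] (f (suc i) * δ i j) ≈⟨ +-cong (zeroʳ _) (∑-δʳ (f ∘ suc) j) ⟩
    0# + f (suc j)                               ≈⟨ +-identityˡ _ ⟩
    f (suc j)                                    ∎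

  pushforward : ∀ {I K} → (Fin I → Fin K) → Vector Carrier I → Vector Carrier K
  pushforward h z u = ∑[ i < _ ] (z i * δ (h i) u)

  ∑-pushforward : ∀ {I K} (h : Fin I → Fin K) (z : Vector Carrier I) (g : Vector Carrier K) →
                  ∑[ u < K ] (pushforward h z u * g u) ≈ ∑[ i < I ] (z i * g (h i))
  ∑-pushforward {I} {K} h z g = begin
    ∑[ u < K ] (∑[ i < I ] (z i * δ (h i) u) * g u)
      ≈⟨ sum-cong-≋ (λ u → *-distribʳ-sum (g u) (λ i → z i * δ (h i) u)) ⟩
    ∑[ u < K ] ∑[ i < I ] (z i * δ (h i) u * g u)
      ≈⟨ ∑-comm (λ u i → z i * δ (h i) u * g u) ⟩
    ∑[ i < I ] ∑[ u < K ] (z i * δ (h i) u * g u)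
      ≈⟨ sum-cong-≋ (λ i → sum-cong-≋ (λ u → *-assoc (z i) (δ (h i) u) (g u))) ⟩
    ∑[ i < I ] ∑[ u < K ] (z i * (δ (h i) u * g u))
      ≈⟨ sum-cong-≋ (λ i → *-distribˡ-sum (z i) (λ u → δ (h i) u * g u)) ⟨
    ∑[ i < I ] (z i * ∑[ u < K ] (δ (h i) u * g u))
      ≈⟨ sum-cong-≋ (λ i → *-congˡ (∑-δˡ (h i) g)) ⟩
    ∑[ i < I ] (z i * g (h i))
      ∎

  pushforward-∘ : ∀ {I J K} (h : Fin J → Fin K) (h′ : Fin I → Fin J) z →
                  pushforward h (pushforward h′ z) ≋ pushforward (h ∘ h′) z
  pushforward-∘ h h′ z u = ∑-pushforward h′ z (λ k → δ (h k) u)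

  pushforward-retraction : ∀ {I K} {h : Fin I → Fin K} {r : Fin K → Fin I} → (∀ i → r (h i) ≡ i) →
                           ∀ z → pushforward r (pushforward h z) ≋ z
  pushforward-retraction {h = h} {r} r∘h≗id z j = begin
    pushforward r (pushforward h z) j  ≈⟨ pushforward-∘ r h z j ⟩
    ∑[ i < _ ] (z i * δ (r (h i)) j)   ≡⟨ sum-cong-≗ (λ i → cong (λ k → z i * δ k j) (r∘h≗id i)) ⟩
    ∑[ i < _ ] (z i * δ i j)           ≈⟨ ∑-δʳ z j ⟩
    z j                                ∎

  pushforward-injective : ∀ {I K} {h : Fin I → Fin K} → (∀ {i j} → h i ≡ h j → i ≡ j) →
                          ∀ z j → pushforward h z (h j) ≈ z j
  pushforward-injective {h = h} h-injective z j = begin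
    ∑[ i < _ ] (z i * δ (h i) (h j)) ≡⟨ sum-cong-≗ (λ i → cong (z i *_) (δ-image i)) ⟩
    ∑[ i < _ ] (z i * δ i j)         ≈⟨ ∑-δʳ z j ⟩
    z j                              ∎
    where
    δ-image : ∀ i → δ (h i) (h j) ≡ δ i j
    δ-image i with i Fin.≟ j
    ... | yes refl = ≡.trans (δ-refl (h i)) (≡.sym (δ-refl i))
    ... | no  i≢j  = ≡.trans (δ-≢ (i≢j ∘ h-injective)) (≡.sym (δ-≢ i≢j))

  pushforward-outsideImage : ∀ {I K} {h : Fin I → Fin K} {u} → (∀ i → h i ≢ u) →
                             ∀ z → pushforward h z u ≈ 0#
  pushforward-outsideImage {I} {h = h} {u} u∉image z = begin
    ∑[ i < I ] (z i * δ (h i) u) ≡⟨ sum-cong-≗ (λ i → cong (z i *_) (δ-≢ (u∉image i))) ⟩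
    ∑[ i < I ] (z i * 0#)        ≈⟨ sum-cong-≋ (zeroʳ ∘ z) ⟩
    ∑[ i < I ] 0#                ≈⟨ sum-replicate-zero I ⟩
    0#                           ∎

Fin-inhabited? : ∀ K → Dec (Fin K)
Fin-inhabited? zero    = no λ ()
Fin-inhabited? (suc K) = yes zero

∣p∣≤∣q∣-injectiveOn : ∀ {K k} (f : Fin K → Fin k) {p : Subset K} {q : Subset k} →
                      (∀ {v} → v ∈ p → f v ∈ q) →
                      (∀ {u v} → u ∈ p → v ∈ p → f u ≡ f v → u ≡ v) →
                      ∣ p ∣ ≤ ∣ q ∣
∣p∣≤∣q∣-injectiveOn f {[]}          _    _   = z≤n
∣p∣≤∣q∣-injectiveOn f {outside ∷ p} into inj =
  ∣p∣≤∣q∣-injectiveOn (f ∘ suc) (into ∘ there) (λ u∈p v∈p → Fin.suc-injective ∘ inj (there u∈p) (there v∈p))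
∣p∣≤∣q∣-injectiveOn f {inside ∷ p} {q} into inj = begin-strict
  ∣ p ∣          ≤⟨ ∣p∣≤∣q∣-injectiveOn (f ∘ suc) into-q-f₀ inj-tail ⟩
  ∣ q - f zero ∣ <⟨ x∈p⇒∣p-x∣<∣p∣ (into here) ⟩
  ∣ q ∣          ∎
  where
  open ℕ.≤-Reasoning
  into-q-f₀ : ∀ {v} → v ∈ p → f (suc v) ∈ q - f zero
  into-q-f₀ v∈p = x∈p∧x≢y⇒x∈p-y (into (there v∈p)) (Fin.0≢1+n ∘ inj here (there v∈p) ∘ ≡.sym)
  inj-tail : ∀ {u v} → u ∈ p → v ∈ p → f (suc u) ≡ f (suc v) → u ≡ v
  inj-tail u∈p v∈p = Fin.suc-injective ∘ inj (there u∈p) (there v∈p)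

injectiveOn⇒surjectiveOn : ∀ {K k} (f : Fin K → Fin (suc k)) {p : Subset K} → ∣ p ∣ ≡ suc k →
                           (∀ {u v} → u ∈ p → v ∈ p → f u ≡ f v → u ≡ v) →
                           ∀ y → ∃ λ v → v ∈ p × f v ≡ y
injectiveOn⇒surjectiveOn {k = k} f {p} ∣p∣≡1+k inj y with Fin.any? (λ v → (v ∈? p) ×-dec (f v Fin.≟ y))
... | yes hit = hit
... | no miss = contradiction ∣p∣<∣p∣ (ℕ.<-irrefl refl)
  where
  open ℕ.≤-Reasoning
  into-⊤-y : ∀ {v} → v ∈ p → f v ∈ ⊤ - y
  into-⊤-y {v} v∈p = x∈p∧x≢y⇒x∈p-y ∈⊤ (miss ∘ (v ,_) ∘ (v∈p ,_))
  ∣p∣<∣p∣ : ∣ p ∣ < ∣ p ∣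
  ∣p∣<∣p∣ = begin-strict
    ∣ p ∣         ≤⟨ ∣p∣≤∣q∣-injectiveOn f into-⊤-y inj ⟩
    ∣ ⊤ - y ∣     <⟨ x∈p⇒∣p-x∣<∣p∣ (∈⊤ {x = y}) ⟩
    ∣ ⊤ {suc k} ∣ ≡⟨ ∣⊤∣≡n (suc k) ⟩
    suc k         ≡⟨ ∣p∣≡1+k ⟨
    ∣ p ∣         ∎

∣p∩q∣≡pred∣p∣⇒p-x⊆q : ∀ {K k} {p q : Subset K} {x} →
                      ∣ p ∣ ≡ suc k → ∣ p ∩ q ∣ ≡ k → x ∈ p → x ∉ q → p - x ⊆ q
∣p∩q∣≡pred∣p∣⇒p-x⊆q {k = k} {p} {q} {x} ∣p∣≡1+k ∣p∩q∣≡k x∈p x∉q {v} v∈p-x with v ∈? q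
... | yes v∈q = v∈q
... | no  v∉q = contradiction k<k (ℕ.<-irrefl refl)
  where
  open ℕ.≤-Reasoning
  p∩q⊆p-x-v : p ∩ q ⊆ p - x - v
  p∩q⊆p-x-v w∈p∩q with x∈p∩q⁻ p q w∈p∩q
  ... | w∈p , w∈q = x∈p∧x≢y⇒x∈p-y (x∈p∧x≢y⇒x∈p-y w∈p λ { refl → x∉q w∈q }) λ { refl → v∉q w∈q }
  k<k : k < k
  k<k = ℕ.≤-pred (begin-strict
    suc k             ≡⟨ cong suc ∣p∩q∣≡k ⟨
    suc ∣ p ∩ q ∣     ≤⟨ s≤s (p⊆q⇒∣p∣≤∣q∣ p∩q⊆p-x-v) ⟩
    suc ∣ p - x - v ∣ ≤⟨ x∈p⇒∣p-x∣<∣p∣ v∈p-x ⟩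
    ∣ p - x ∣         <⟨ x∈p⇒∣p-x∣<∣p∣ x∈p ⟩
    ∣ p ∣             ≡⟨ ∣p∣≡1+k ⟩
    suc k             ∎)

-- ℤ/mℤ with carrier ℕ (equality is congruence mod m) rather than Fin m, so that the natural numbers
-- toℕ (L v) and toℕ (iMat …) of Defs are ring elements as they stand; negation is multiplication by m ∸ 1.
module ModularArithmetic (m : ℕ) .{{_ : NonZero m}} where

  infix 4 _≈_
  _≈_ : ℕ → ℕ → Set
  _≈_ = _≡_ on (_% m)

  ≡⇒≈ : ∀ {a b} → a ≡ b → a ≈ b
  ≡⇒≈ = cong (_% m)

  +-cong : ∀ {a b x y} → a ≈ b → x ≈ y → a ℕ.+ x ≈ b ℕ.+ y
  +-cong {a} {b} {x} {y} a≈b x≈y = begin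
    (a ℕ.+ x) % m             ≡⟨ %-distribˡ-+ a x m ⟩
    (a % m ℕ.+ x % m) % m     ≡⟨ cong₂ (λ s t → (s ℕ.+ t) % m) a≈b x≈y ⟩
    (b % m ℕ.+ y % m) % m     ≡⟨ %-distribˡ-+ b y m ⟨
    (b ℕ.+ y) % m             ∎
    where open ≡-Reasoning

  *-cong : ∀ {a b x y} → a ≈ b → x ≈ y → a ℕ.* x ≈ b ℕ.* y
  *-cong {a} {b} {x} {y} a≈b x≈y = begin
    (a ℕ.* x) % m             ≡⟨ %-distribˡ-* a x m ⟩
    (a % m ℕ.* (x % m)) % m   ≡⟨ cong₂ (λ s t → (s ℕ.* t) % m) a≈b x≈y ⟩
    (b % m ℕ.* (y % m)) % m   ≡⟨ %-distribˡ-* b y m ⟨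
    (b ℕ.* y) % m             ∎
    where open ≡-Reasoning

  infix 8 -_
  -_ : ℕ → ℕ
  - x = (m ∸ 1) ℕ.* x

  -‿inverseʳ : ∀ x → x ℕ.+ - x ≈ 0
  -‿inverseʳ x = begin
    (x ℕ.+ (m ∸ 1) ℕ.* x) % m ≡⟨ cong (λ k → (k ℕ.* x) % m) (ℕ.suc-pred m) ⟩
    (m ℕ.* x) % m             ≡⟨ cong (_% m) (ℕ.*-comm m x) ⟩
    (x ℕ.* m) % m             ≡⟨ m*n%n≡0 x m ⟩
    0                         ≡⟨ m*n%n≡0 0 m ⟨
    0 % m                     ∎
    where open ≡-Reasoning

  ℤ/m : CommutativeRing 0ℓ 0ℓ
  ℤ/m = record
    { Carrier = ℕ ; _≈_ = _≈_ ; _+_ = ℕ._+_ ; _*_ = ℕ._*_ ; -_ = -_ ; 0# = 0 ; 1# = 1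
    ; isCommutativeRing = record
      { isRing = record
        { +-isAbelianGroup = record
          { isGroup = record
            { isMonoid = record
              { isSemigroup = record
                { isMagma = record { isEquivalence = On.isEquivalence (_% m) isEquivalence ; ∙-cong = +-cong }
                ; assoc = λ x y z → ≡⇒≈ (ℕ.+-assoc x y z) }
              ; identity = (λ _ → refl) , λ x → ≡⇒≈ (ℕ.+-identityʳ x) }
            ; inverse = (λ x → ≡.trans (≡⇒≈ (ℕ.+-comm (- x) x)) (-‿inverseʳ x)) , -‿inverseʳ
            ; ⁻¹-cong = *-cong {m ∸ 1} refl }
          ; comm = λ x y → ≡⇒≈ (ℕ.+-comm x y) }
        ; *-cong = *-cong
        ; *-assoc = λ x y z → ≡⇒≈ (ℕ.*-assoc x y z)
        ; *-identity = (λ x → ≡⇒≈ (ℕ.*-identityˡ x)) , λ x → ≡⇒≈ (ℕ.*-identityʳ x)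
        ; distrib = (λ x y z → ≡⇒≈ (ℕ.*-distribˡ-+ x y z)) , λ x y z → ≡⇒≈ (ℕ.*-distribʳ-+ x y z) }
      ; *-comm = λ x y → ≡⇒≈ (ℕ.*-comm x y) } }

module Rainbow (G : Graph) {n : ℕ} {c : Fin (Graph.N G) → Fin (suc n)} (proper : Proper G c) where
  open Graph G using (N)

  simplex-injective : (S : Simplex G n) → ∀ {u v} → u ∈ proj₁ S → v ∈ proj₁ S → c u ≡ c v → u ≡ v
  simplex-injective (_ , _ , clique) {u} {v} u∈S v∈S cu≡cv =
    decidable-stable (u Fin.≟ v) (λ u≢v → proper u v (clique u v u∈S v∈S u≢v) cu≡cv)

  private
    vertexOfColour : (S : Simplex G n) (k : Fin (suc n)) → ∃ λ v → v ∈ proj₁ S × c v ≡ k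
    vertexOfColour S@(_ , ∣S∣≡1+n , _) = injectiveOn⇒surjectiveOn c ∣S∣≡1+n (simplex-injective S)

  vertex : Simplex G n → Fin (suc n) → Fin N
  vertex S k = proj₁ (vertexOfColour S k)

  vertex-∈ : ∀ S k → vertex S k ∈ proj₁ S
  vertex-∈ S k = proj₁ (proj₂ (vertexOfColour S k))

  colour-vertex : ∀ S k → c (vertex S k) ≡ k
  colour-vertex S k = proj₂ (proj₂ (vertexOfColour S k))

  vertex-colour : ∀ S {u} → u ∈ proj₁ S → vertex S (c u) ≡ u
  vertex-colour S u∈S = simplex-injective S (vertex-∈ S _) u∈S (colour-vertex S _)

  vertex-injective : ∀ S {k l} → vertex S k ≡ vertex S l → k ≡ l
  vertex-injective S {k} {l} eq = ≡.trans (≡.sym (colour-vertex S k)) (≡.trans (cong c eq) (colour-vertex S l))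

module Reachability (m : ℕ) .{{_ : NonZero m}} where
  open ModularArithmetic m using (ℤ/m)
  open CommutativeRing ℤ/m hiding (_-_; refl; zero)
  open AbelianGroupProperties +-abelianGroup using (x∙y⁻¹≈ε⇒x≈y; //-rightDividesˡ)
  open RingProperties ring using (-‿distribˡ-*; -‿distribʳ-*)
  open SemiringSum semiring
  open KroneckerDelta semiring
  open VecEquality setoid using (_≋_)
  open SetoidReasoning setoid

  toℕ-mod : ∀ a → toℕ (a mod m) ≈ a
  toℕ-mod a = ≡.trans (cong (_% m) (Fin.toℕ-fromℕ< _)) (m%n%n≡m%n a m)

  toℕ-≈-injective : ∀ {a b : Fin m} → toℕ a ≈ toℕ b → a ≡ b
  toℕ-≈-injective {a} {b} a≈b = Fin.toℕ-injective (≡.trans (≡.sym (reduced a)) (≡.trans a≈b (reduced b)))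
    where
    reduced : ∀ (a : Fin m) → toℕ a % m ≡ toℕ a
    reduced a = m<n⇒m%n≡m (Fin.toℕ<n a)

  -‿distrib-∑ : ∀ {K} (f : Vector ℕ K) → - ∑[ i < K ] f i ≈ ∑[ i < K ] (- f i)
  -‿distrib-∑ = *-distribˡ-sum (m ∸ 1)

  telescope : ∀ a b c → (a + - b) + (b + - c) ≈ a + - c
  telescope a b c = begin
    (a + - b) + (b + - c)  ≈⟨ +-assoc (a + - b) b (- c) ⟨
    (a + - b) + b + - c    ≈⟨ +-congʳ (//-rightDividesˡ b a) ⟩
    a + - c                ∎

  𝟙 : ∀ {K} → Subset K → Vector ℕ K
  𝟙 p u = if lookup p u then 1 else 0

  𝟙-∈ : ∀ {K} {p : Subset K} {u} → u ∈ p → 𝟙 p u ≡ 1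
  𝟙-∈ u∈p = cong (if_then 1 else 0) ([]=⇒lookup u∈p)

  𝟙-∉ : ∀ {K} {p : Subset K} {u} → u ∉ p → 𝟙 p u ≡ 0
  𝟙-∉ {p = p} {u} u∉p with lookup p u in eq
  ... | true  = contradiction (lookup⇒[]= u p eq) u∉p
  ... | false = refl

  𝟙-cong : ∀ {K} {p q : Subset K} {u} → (u ∈ p → u ∈ q) → (u ∈ q → u ∈ p) → 𝟙 p u ≡ 𝟙 q u
  𝟙-cong {p = p} {u = u} p→q q→p with u ∈? p
  ... | yes u∈p = ≡.trans (𝟙-∈ u∈p) (≡.sym (𝟙-∈ (p→q u∈p)))
  ... | no  u∉p = ≡.trans (𝟙-∉ u∉p) (≡.sym (𝟙-∉ (u∉p ∘ q→p)))

  𝟙-exchange : ∀ {K} {p q : Subset K} {a b} → a ∈ p → a ∉ q → b ∈ q → b ∉ p → p - a ⊆ q → q - b ⊆ p →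
               ∀ u → 𝟙 p u + - 𝟙 q u ≈ δ a u + - δ b u
  𝟙-exchange {p = p} {q} {a} {b} a∈p a∉q b∈q b∉p p-a⊆q q-b⊆p u with u Fin.≟ a | u Fin.≟ b
  ... | yes refl | _        = reflexive (cong₂ (λ s t → s + - t)
    (≡.trans (𝟙-∈ a∈p) (≡.sym (δ-refl a))) (≡.trans (𝟙-∉ a∉q) (≡.sym (δ-≢ {i = b} λ { refl → b∉p a∈p }))))
  ... | no _     | yes refl = reflexive (cong₂ (λ s t → s + - t)
    (≡.trans (𝟙-∉ b∉p) (≡.sym (δ-≢ {i = a} λ { refl → b∉p a∈p }))) (≡.trans (𝟙-∈ b∈q) (≡.sym (δ-refl b))))
  ... | no u≢a   | no u≢b   = begin
    𝟙 p u + - 𝟙 q u  ≡⟨ cong (λ t → 𝟙 p u + - t) (𝟙-cong p→q q→p) ⟨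
    𝟙 p u + - 𝟙 p u  ≈⟨ -‿inverseʳ (𝟙 p u) ⟩
    0                ≈⟨ -‿inverseʳ 0 ⟨
    0 + - 0          ≡⟨ cong₂ (λ s t → s + - t) (δ-≢ {i = a} (u≢a ∘ ≡.sym)) (δ-≢ {i = b} (u≢b ∘ ≡.sym)) ⟨
    δ a u + - δ b u  ∎
    where
    p→q = λ u∈p → p-a⊆q (x∈p∧x≢y⇒x∈p-y u∈p u≢a)
    q→p = λ u∈q → q-b⊆p (x∈p∧x≢y⇒x∈p-y u∈q u≢b)

  module Pushes (G : Graph) (n : ℕ) where
    open Graph G using (N)

    Reachable : Labeling G m → Labeling G m → Set
    Reachable L₁ L₂ = ∃ λ (ss : List (Simplex G n)) → ∀ v → applyPushes G m ss L₁ v ≡ L₂ v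

    pushCount : List (Simplex G n) → Vector ℕ N
    pushCount ss u = ℕ.sum (List.map (λ S → 𝟙 (proj₁ S) u) ss)

    push-≈ : ∀ (S : Simplex G n) L u → toℕ (push G m S L u) ≈ toℕ (L u) + 𝟙 (proj₁ S) u
    push-≈ S L u with lookup (proj₁ S) u
    ... | true  = ≡.trans (toℕ-mod (suc (toℕ (L u)))) (reflexive (ℕ.+-comm 1 (toℕ (L u))))
    ... | false = sym (+-identityʳ (toℕ (L u)))

    applyPushes-≈ : ∀ ss L u → toℕ (applyPushes G m ss L u) ≈ toℕ (L u) + pushCount ss u
    applyPushes-≈ []       L u = sym (+-identityʳ (toℕ (L u)))
    applyPushes-≈ (S ∷ ss) L u = begin
      toℕ (applyPushes G m ss (push G m S L) u)  ≈⟨ applyPushes-≈ ss (push G m S L) u ⟩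
      toℕ (push G m S L u) + pushCount ss u      ≈⟨ +-congʳ (push-≈ S L u) ⟩
      toℕ (L u) + 𝟙 (proj₁ S) u + pushCount ss u ≈⟨ +-assoc (toℕ (L u)) (𝟙 (proj₁ S) u) (pushCount ss u) ⟩
      toℕ (L u) + pushCount (S ∷ ss) u          ∎

    Span : Vector ℕ N → Set
    Span x = ∃ λ ss → pushCount ss ≋ x

    Span-cong : ∀ {x y} → Span x → x ≋ y → Span y
    Span-cong (ss , ss≋x) x≋y = ss , λ u → trans (ss≋x u) (x≋y u)

    Span-0 : Span (λ _ → 0)
    Span-0 = [] , λ _ → refl

    Span-+ : ∀ {x y} → Span x → Span y → Span (λ u → x u + y u)
    Span-+ {x} {y} (ss , ss≋x) (ts , ts≋y) = ss ++ ts , λ u → begin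
      pushCount (ss ++ ts) u                        ≡⟨ cong ℕ.sum (List.map-++ (count u) ss ts) ⟩
      ℕ.sum (List.map (count u) ss ++ List.map (count u) ts) ≡⟨ ℕ.sum-++ (List.map (count u) ss) _ ⟩
      pushCount ss u + pushCount ts u               ≈⟨ +-cong (ss≋x u) (ts≋y u) ⟩
      x u + y u                                     ∎
      where count = λ u (S : Simplex G n) → 𝟙 (proj₁ S) u

    Span-𝟙 : ∀ S → Span (𝟙 (proj₁ S))
    Span-𝟙 S = List.[ S ] , λ u → +-identityʳ (𝟙 (proj₁ S) u)

    Span-scale : ∀ {x} k → Span x → Span (λ u → k * x u)
    Span-scale zero    _      = Span-0
    Span-scale (suc k) x-span = Span-+ x-span (Span-scale k x-span)

    Span-neg : ∀ {x} → Span x → Span (λ u → - x u)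
    Span-neg = Span-scale (m ∸ 1)

    Span-∑ : ∀ {I} (f : Fin I → Vector ℕ N) → (∀ i → Span (f i)) → Span (λ u → ∑[ i < I ] f i u)
    Span-∑ {zero}  f _      = Span-0
    Span-∑ {suc I} f f-span = Span-+ (f-span zero) (Span-∑ (f ∘ suc) (f-span ∘ suc))

    module Colouring {c : Fin N → Fin (suc n)} (proper : Proper G c) where
      open Rainbow G proper

      τ : Fin (suc n) → Fin n → ℕ
      τ k j = toℕ (iMat G m n k j)

      τ-fromℕ : ∀ j → τ (fromℕ n) j ≈ - 1
      τ-fromℕ j rewrite dec-true (toℕ (fromℕ n) ℕ.≟ n) (Fin.toℕ-fromℕ n) =
        trans (toℕ-mod (m ∸ 1)) (sym (*-identityʳ (m ∸ 1)))

      τ-inject₁ : ∀ i j → τ (inject₁ i) j ≈ δ i j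
      τ-inject₁ i j rewrite dec-false (toℕ (inject₁ i) ℕ.≟ n) (Fin.toℕ-inject₁-≢ i ∘ ≡.sym) with j Fin.≟ i
      ... | yes refl rewrite dec-true (toℕ j ℕ.≟ toℕ (inject₁ j)) (≡.sym (Fin.toℕ-inject₁ j)) =
        trans (toℕ-mod 1) (reflexive (≡.sym (δ-refl j)))
      ... | no j≢i
        rewrite dec-false (toℕ j ℕ.≟ toℕ (inject₁ i)) (j≢i ∘ Fin.toℕ-injective ∘ flip ≡.trans (Fin.toℕ-inject₁ i)) =
        trans (toℕ-mod 0) (reflexive (≡.sym (δ-≢ (j≢i ∘ ≡.sym))))

      τ-∑ : ∀ (z : Vector ℕ (suc n)) j → ∑[ k < suc n ] (z k * τ k j) ≈ z (inject₁ j) + - z (fromℕ n)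
      τ-∑ z j = begin
        ∑[ k < suc n ] (z k * τ k j)
          ≈⟨ sum-init-last (λ k → z k * τ k j) ⟩
        ∑[ i < n ] (z (inject₁ i) * τ (inject₁ i) j) + z (fromℕ n) * τ (fromℕ n) j
          ≈⟨ +-cong (sum-cong-≋ (λ i → *-congˡ {z (inject₁ i)} (τ-inject₁ i j)))
                    (*-congˡ {z (fromℕ n)} (τ-fromℕ j)) ⟩
        ∑[ i < n ] (z (inject₁ i) * δ i j) + z (fromℕ n) * - 1
          ≈⟨ +-cong (∑-δʳ (z ∘ inject₁) j) (sym (-‿distribʳ-* (z (fromℕ n)) 1)) ⟩
        z (inject₁ j) + - (z (fromℕ n) * 1)
          ≈⟨ +-congˡ (-‿cong (*-identityʳ (z (fromℕ n)))) ⟩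
        z (inject₁ j) + - z (fromℕ n)
          ∎

      weight : Vector ℕ N → Fin n → ℕ
      weight x j = ∑[ v < N ] (x v * τ (c v) j)

      SameWeight : Labeling G m → Labeling G m → Set
      SameWeight L₁ L₂ = ∀ j → weight (toℕ ∘ L₁) j ≈ weight (toℕ ∘ L₂) j

      colourSums : Vector ℕ N → Vector ℕ (suc n)
      colourSums = pushforward c

      weight≈colourSums : ∀ x j → weight x j ≈ colourSums x (inject₁ j) + - colourSums x (fromℕ n)
      weight≈colourSums x j = begin
        ∑[ v < N ] (x v * τ (c v) j)               ≈⟨ ∑-pushforward c x (λ k → τ k j) ⟨
        ∑[ k < suc n ] (colourSums x k * τ k j)    ≈⟨ τ-∑ (colourSums x) j ⟩
        colourSums x (inject₁ j) + - colourSums x (fromℕ n) ∎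

      weight-cong : ∀ {x y} → x ≋ y → ∀ j → weight x j ≈ weight y j
      weight-cong x≋y j = sum-cong-≋ (λ v → *-congʳ (x≋y v))

      weight-+ : ∀ x y j → weight (λ v → x v + y v) j ≈ weight x j + weight y j
      weight-+ x y j = begin
        ∑[ v < N ] ((x v + y v) * τ (c v) j)
          ≈⟨ sum-cong-≋ (λ v → distribʳ (τ (c v) j) (x v) (y v)) ⟩
        ∑[ v < N ] (x v * τ (c v) j + y v * τ (c v) j)
          ≈⟨ ∑-distrib-+ (λ v → x v * τ (c v) j) (λ v → y v * τ (c v) j) ⟩
        weight x j + weight y j
          ∎

      weight-neg : ∀ x j → weight (λ v → - x v) j ≈ - weight x j
      weight-neg x j = begin
        ∑[ v < N ] (- x v * τ (c v) j)     ≈⟨ sum-cong-≋ (λ v → -‿distribˡ-* (x v) (τ (c v) j)) ⟨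
        ∑[ v < N ] (- (x v * τ (c v) j))   ≈⟨ -‿distrib-∑ (λ v → x v * τ (c v) j) ⟨
        - weight x j                       ∎

      𝟙≋pushforward-vertex : ∀ S → 𝟙 (proj₁ S) ≋ pushforward (vertex S) (replicate (suc n) 1)
      𝟙≋pushforward-vertex S u with u ∈? proj₁ S
      ... | yes u∈S = begin
        𝟙 (proj₁ S) u           ≡⟨ 𝟙-∈ u∈S ⟩
        1                       ≈⟨ pushforward-injective (vertex-injective S) 1s (c u) ⟨
        e (vertex S (c u))      ≡⟨ cong e (vertex-colour S u∈S) ⟩
        e u                     ∎
        where
        1s = replicate (suc n) 1
        e = pushforward (vertex S) 1s
      ... | no u∉S = begin
        𝟙 (proj₁ S) u           ≡⟨ 𝟙-∉ u∉S ⟩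
        0                       ≈⟨ pushforward-outsideImage outside-image (replicate (suc n) 1) ⟨
        pushforward (vertex S) (replicate (suc n) 1) u ∎
        where
        outside-image : ∀ k → vertex S k ≢ u
        outside-image k refl = u∉S (vertex-∈ S k)

      weight-𝟙 : ∀ S j → weight (𝟙 (proj₁ S)) j ≈ 0
      weight-𝟙 S j = begin
        weight (𝟙 (proj₁ S)) j                ≈⟨ weight-cong (𝟙≋pushforward-vertex S) j ⟩
        weight (pushforward (vertex S) 1s) j  ≈⟨ weight≈colourSums (pushforward (vertex S) 1s) j ⟩
        X (inject₁ j) + - X (fromℕ n)         ≈⟨ +-cong (rainbow (inject₁ j)) (-‿cong {X (fromℕ n)} (rainbow (fromℕ n))) ⟩
        1 + - 1                               ≈⟨ -‿inverseʳ 1 ⟩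
        0                                     ∎
        where
        1s = replicate (suc n) 1
        X = colourSums (pushforward (vertex S) 1s)
        rainbow : X ≋ 1s
        rainbow = pushforward-retraction {h = vertex S} {r = c} (colour-vertex S) 1s

      weight-pushCount : ∀ ss j → weight (pushCount ss) j ≈ 0
      weight-pushCount []       j = sum-replicate-zero N
      weight-pushCount (S ∷ ss) j = begin
        weight (pushCount (S ∷ ss)) j                    ≈⟨ weight-+ (𝟙 (proj₁ S)) (pushCount ss) j ⟩
        weight (𝟙 (proj₁ S)) j + weight (pushCount ss) j ≈⟨ +-cong (weight-𝟙 S j) (weight-pushCount ss j) ⟩
        0 + 0                                            ≈⟨ +-identityʳ 0 ⟩
        0                                                ∎

      reachable⇒sameWeight : ∀ L₁ L₂ → Reachable L₁ L₂ → SameWeight L₁ L₂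
      reachable⇒sameWeight L₁ L₂ (ss , reached) j = begin
        weight (toℕ ∘ L₁) j                           ≈⟨ +-identityʳ _ ⟨
        weight (toℕ ∘ L₁) j + 0                       ≈⟨ +-congˡ (weight-pushCount ss j) ⟨
        weight (toℕ ∘ L₁) j + weight (pushCount ss) j ≈⟨ weight-+ (toℕ ∘ L₁) (pushCount ss) j ⟨
        weight (λ u → toℕ (L₁ u) + pushCount ss u) j  ≈⟨ weight-cong L₁+pushCount≋L₂ j ⟩
        weight (toℕ ∘ L₂) j                           ∎
        where
        L₁+pushCount≋L₂ : ∀ u → toℕ (L₁ u) + pushCount ss u ≈ toℕ (L₂ u)
        L₁+pushCount≋L₂ u = trans (sym (applyPushes-≈ ss L₁ u)) (reflexive (cong toℕ (reached u)))

      toℕ-P : ∀ L j → toℕ (P G m c L j) ≈ weight (toℕ ∘ L) j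
      toℕ-P L j = toℕ-∏ id
        where
        toℕ-∏ : ∀ {K} (g : Fin K → Fin N) →
                toℕ (List.foldr (λ v A → _⊗_ G m (_^^_ G m (iMat G m n (c v)) (toℕ (L v))) A)
                                (idMat G m n) (List.tabulate g) j)
                ≈ ∑[ i < K ] (toℕ (L (g i)) * τ (c (g i)) j)
        toℕ-∏ {zero}  g = toℕ-mod 0
        toℕ-∏ {suc K} g = trans (toℕ-mod _) (+-cong (toℕ-mod _) (toℕ-∏ (g ∘ suc)))

      sameWeight⇔sameP : ∀ L₁ L₂ → SameWeight L₁ L₂ ⇔ (∀ j → P G m c L₁ j ≡ P G m c L₂ j)
      sameWeight⇔sameP L₁ L₂ = mk⇔
        (λ same-weight j → toℕ-≈-injective (trans (toℕ-P L₁ j) (trans (same-weight j) (sym (toℕ-P L₂ j)))))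
        (λ same-P j → trans (sym (toℕ-P L₁ j)) (trans (reflexive (cong toℕ (same-P j))) (toℕ-P L₂ j)))

      Span-δ-δ : ∀ a → Span (λ u → δ a u + - δ a u)
      Span-δ-δ a = Span-cong Span-0 (λ u → sym (-‿inverseʳ (δ a u)))

      Span-δ-vertex-adjacent : ∀ {S S′} → AdjSimplex G n S S′ →
                               ∀ k → Span (λ u → δ (vertex S k) u + - δ (vertex S′ k) u)
      Span-δ-vertex-adjacent {S} {S′} adjacent k with vertex S k Fin.≟ vertex S′ k
      ... | yes a≡b rewrite a≡b = Span-δ-δ (vertex S′ k)
      ... | no  a≢b = Span-cong (Span-+ (Span-𝟙 S) (Span-neg (Span-𝟙 S′)))
                                (𝟙-exchange a∈S a∉S′ b∈S′ b∉S S-a⊆S′ S′-b⊆S)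
        where
        a∈S  = vertex-∈ S k
        b∈S′ = vertex-∈ S′ k
        same-colour = ≡.trans (colour-vertex S k) (≡.sym (colour-vertex S′ k))
        a∉S′ : vertex S k ∉ proj₁ S′
        a∉S′ a∈S′ = a≢b (simplex-injective S′ a∈S′ b∈S′ same-colour)
        b∉S : vertex S′ k ∉ proj₁ S
        b∉S b∈S = a≢b (simplex-injective S a∈S b∈S same-colour)
        S-a⊆S′ = ∣p∩q∣≡pred∣p∣⇒p-x⊆q (proj₁ (proj₂ S)) adjacent a∈S a∉S′
        S′-b⊆S = ∣p∩q∣≡pred∣p∣⇒p-x⊆q (proj₁ (proj₂ S′))
                   (≡.trans (cong ∣_∣ (∩-comm (proj₁ S′) (proj₁ S))) adjacent) b∈S′ b∉S

      Span-δ-vertex-connected : ∀ {S S′} → Star (AdjSimplex G n) S S′ →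
                                ∀ k → Span (λ u → δ (vertex S k) u + - δ (vertex S′ k) u)
      Span-δ-vertex-connected {S} ε k = Span-δ-δ (vertex S k)
      Span-δ-vertex-connected {S} {S″} (_◅_ {j = S′} adjacent path) k =
        Span-cong (Span-+ (Span-δ-vertex-adjacent {S} {S′} adjacent k) (Span-δ-vertex-connected path k))
                  (λ u → telescope (δ (vertex S k) u) (δ (vertex S′ k) u) (δ (vertex S″ k) u))

      project : Simplex G n → Vector ℕ N → Vector ℕ N
      project S x = pushforward (vertex S) (colourSums x)

      module _ (simplicial : IsSimplexGraph G n) (connected : RegionConnected G n) where

        Span-δ-vertex : ∀ S v → Span (λ u → δ v u + - δ (vertex S (c v)) u)
        Span-δ-vertex S v with proj₁ simplicial v
        ... | Sᵥ , v∈Sᵥ = ≡.subst (λ w → Span (λ u → δ w u + - δ (vertex S (c v)) u)) (vertex-colour Sᵥ v∈Sᵥ)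
                                  (Span-δ-vertex-connected (connected Sᵥ S) (c v))

        Span-minus-project : ∀ S x → Span (λ u → x u + - project S x u)
        Span-minus-project S x = Span-cong (Span-∑ _ (λ v → Span-scale (x v) (Span-δ-vertex S v))) pointwise
          where
          pointwise : ∀ u → ∑[ v < N ] (x v * (δ v u + - δ (vertex S (c v)) u)) ≈ x u + - project S x u
          pointwise u = begin
            ∑[ v < N ] (x v * (δ v u + - δ (vertex S (c v)) u))
              ≈⟨ sum-cong-≋ (λ v → trans (distribˡ (x v) _ _) (+-congˡ (sym (-‿distribʳ-* (x v) _)))) ⟩
            ∑[ v < N ] (x v * δ v u + - (x v * δ (vertex S (c v)) u))
              ≈⟨ ∑-distrib-+ (λ v → x v * δ v u) (λ v → - (x v * δ (vertex S (c v)) u)) ⟩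
            ∑[ v < N ] (x v * δ v u) + ∑[ v < N ] (- (x v * δ (vertex S (c v)) u))
              ≈⟨ +-cong (∑-δʳ x u) (sym (-‿distrib-∑ (λ v → x v * δ (vertex S (c v)) u))) ⟩
            x u + - pushforward (vertex S ∘ c) x u
              ≈⟨ +-congˡ (-‿cong (sym (pushforward-∘ (vertex S) c x u))) ⟩
            x u + - project S x u
              ∎

        weight≈0⇒Span-at : Simplex G n → ∀ x → (∀ j → weight x j ≈ 0) → Span x
        weight≈0⇒Span-at S x weight≈0 =
          Span-cong (Span-+ (Span-minus-project S x) project-Span)
                    (λ u → //-rightDividesˡ (project S x u) (x u))
          where
          X = colourSums x

          X-constant : ∀ k → X k ≈ X (fromℕ n)
          X-constant k with view k
          ... | ‵fromℕ     = refl
          ... | ‵inject₁ j = x∙y⁻¹≈ε⇒x≈y _ _ (trans (sym (weight≈colourSums x j)) (weight≈0 j))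

          X₀𝟙≋project : ∀ u → X (fromℕ n) * 𝟙 (proj₁ S) u ≈ project S x u
          X₀𝟙≋project u = begin
            X (fromℕ n) * 𝟙 (proj₁ S) u
              ≈⟨ *-congˡ {X (fromℕ n)} (𝟙≋pushforward-vertex S u) ⟩
            X (fromℕ n) * ∑[ k < suc n ] (1 * δ (vertex S k) u)
              ≈⟨ *-distribˡ-sum (X (fromℕ n)) (λ k → 1 * δ (vertex S k) u) ⟩
            ∑[ k < suc n ] (X (fromℕ n) * (1 * δ (vertex S k) u))
              ≈⟨ sum-cong-≋ (λ k → *-cong (sym (X-constant k)) (*-identityˡ (δ (vertex S k) u))) ⟩
            project S x u
              ∎

          project-Span : Span (project S x)
          project-Span = Span-cong (Span-scale (X (fromℕ n)) (Span-𝟙 S)) X₀𝟙≋project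

        weight≈0⇒Span : ∀ x → (∀ j → weight x j ≈ 0) → Span x
        weight≈0⇒Span x with Fin-inhabited? N
        ... | yes v = weight≈0⇒Span-at (proj₁ (proj₁ simplicial v)) x
        ... | no ¬v = λ _ → [] , λ v → contradiction v ¬v

        sameWeight⇒reachable : ∀ L₁ L₂ → SameWeight L₁ L₂ → Reachable L₁ L₂
        sameWeight⇒reachable L₁ L₂ same-weight = ss , λ u → toℕ-≈-injective (begin
          toℕ (applyPushes G m ss L₁ u)               ≈⟨ applyPushes-≈ ss L₁ u ⟩
          toℕ (L₁ u) + pushCount ss u                 ≈⟨ +-congˡ (ss≋d u) ⟩
          toℕ (L₁ u) + (toℕ (L₂ u) + - toℕ (L₁ u))    ≈⟨ +-comm (toℕ (L₁ u)) (d u) ⟩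
          toℕ (L₂ u) + - toℕ (L₁ u) + toℕ (L₁ u)      ≈⟨ //-rightDividesˡ (toℕ (L₁ u)) (toℕ (L₂ u)) ⟩
          toℕ (L₂ u)                                  ∎)
          where
          d : Vector ℕ N
          d u = toℕ (L₂ u) + - toℕ (L₁ u)

          weight-d : ∀ j → weight d j ≈ 0
          weight-d j = begin
            weight d j
              ≈⟨ weight-+ (toℕ ∘ L₂) (λ u → - toℕ (L₁ u)) j ⟩
            weight (toℕ ∘ L₂) j + weight (λ u → - toℕ (L₁ u)) j
              ≈⟨ +-cong (sym (same-weight j)) (weight-neg (toℕ ∘ L₁) j) ⟩
            weight (toℕ ∘ L₁) j + - weight (toℕ ∘ L₁) j
              ≈⟨ -‿inverseʳ _ ⟩
            0
              ∎

          ss = proj₁ (weight≈0⇒Span d weight-d)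
          ss≋d = proj₂ (weight≈0⇒Span d weight-d)

theorem4p5p1 : (n m : ℕ) → 1 ≤ n → 2 ≤ m → .{{_ : NonZero m}} →
    (G : Graph) → IsSimplexGraph G n → RegionConnected G n →
    ChromaticNumber G (suc n) →
    (c : Fin (Graph.N G) → Fin (suc n)) → Proper G c →
    (L₁ L₂ : Labeling G m) →
    (∃ λ (ss : List (Simplex G n)) → ∀ v → applyPushes G m ss L₁ v ≡ L₂ v)
      ⇔ (∀ k → P G m c L₁ k ≡ P G m c L₂ k)
theorem4p5p1 n m _ _ G simplicial connected _ c proper L₁ L₂ =
  Equivalence.trans
    (mk⇔ (reachable⇒sameWeight L₁ L₂) (sameWeight⇒reachable simplicial connected L₁ L₂))
    (sameWeight⇔sameP L₁ L₂)
  where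
  open Reachability m
  open Pushes G n
  open Colouring proper
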